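{- Let $G$ be a finite bipartite graph with bipartition $(X,Y)$, let $k$ be an odd positive integer, and let $a_1a_2\dots a_k$ and $b_1b_2\dots b_k$ be standard congruent walks with $a_1,b_1\in X$, $a_1\ne b_1$. Suppose $c_1\in X\setminus\{a_1,b_1\}$ satisfies: the pair $(a_1,c_1)$ is relevant; $(a_1,c_1)$ is not $\Gamma$-related to $(a_1,b_1)$; and $(c_1,b_1)$ is not $\Gamma$-related to $(a_1,b_1)$. Then $(a_1,c_1)\,\Gamma\,(a_k,c_1)$ and $(c_1,b_1)\,\Gamma\,(c_1,b_k)$. Moreover (for $k\ge 3$), $c_1$ is either adjacent to both $a_{k-1}$ and $b_{k-1}$ or adjacent to neither of them.
   Context: Two edges $xy,x'y'$ ($x,x'\in X$, $y,y'\in Y$) are independent if $x\ne x'$, $y\ne y'$, $xy'\notin E(G)$ and $x'y\notin E(G)$. Two walks $a_1\dots a_k$, $b_1\dots b_k$ with $a_1,b_1$ in the same part are congruent if for each $i=1,\dots,k-1$ the edges $a_ia_{i+1}$ and $b_ib_{i+1}$ are independent; they are standard if moreover for each $i=1,\dots,k-2$ we have $a_i=a_{i+2}$ or $b_i=b_{i+2}$. Let $\mathcal F$ be the set of ordered pairs $(a,b)$ of distinct vertices both in $X$ or both in $Y$. For $(a,b),(f,g)\in\mathcal F$, $(a,b)\,\Gamma\,(f,g)$ means there exist congruent walks from $a$ to $f$ and from $b$ to $g$. The implication class of $(a,b)\in\mathcal F$ is the set of $(f,g)\in\mathcal F$ with $(a,b)\,\Gamma\,(f,g)$; $(a,b)$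 is relevant if its implication class contains at least two pairs. -}

module Defs where

open import Data.Nat using (ℕ; zero; suc; _+_; _≤_)
open import Data.Fin using (Fin)
open import Data.Bool using (Bool; true; false)
open import Data.Product using (Σ; _×_; _,_; ∃)
open import Data.Sum using (_⊎_)
open import Relation.Nullary using (¬_)
open import Relation.Binary.PropositionalEquality using (_≡_; _≢_)

-- A finite bipartite graph on vertex set Fin n with bipartition (X , Y):
-- X = { v | inX v ≡ true },  Y = { v | inX v ≡ false }.
record BipartiteGraph : Set where
  field
    n     : ℕ
    inX   : Fin n → Bool
    adj   : Fin n → Fin n → Bool
    adj-sym : ∀ u v → adj u v ≡ adj v u
    bipartite : ∀ u v → adj u v ≡ true → inX u ≢ inX v

module _ (G : BipartiteGraph) where
  open BipartiteGraph G

  V : Set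
  V = Fin n

  E : V → V → Set
  E u v = adj u v ≡ true

  SamePart : V → V → Set
  SamePart u v = inX u ≡ inX v

  -- Edges uv and u'v' (u, u' in the same part) are independent:
  -- both are edges, u ≠ u', v ≠ v', uv' ∉ E, u'v ∉ E.
  -- (With x = the X-end and y = the Y-end this is exactly the paper's
  --  definition, since E is symmetric.)
  Independent : V → V → V → V → Set
  Independent u v u' v' =
    E u v × E u' v' × u ≢ u' × v ≢ v' × ¬ E u v' × ¬ E u' v

  -- Walks with k vertices are given as functions ℕ → V, using indices 1..k
  -- (values at other indices are irrelevant).
  -- Congruent walks a_1..a_k and b_1..b_k.
  Congruent : ℕ → (ℕ → V) → (ℕ → V) → Set
  Congruent k a b =
    SamePart (a 1) (b 1) ×
    (∀ i → 1 ≤ i → suc i ≤ k → Independent (a i) (a (suc i)) (b i) (b (suc i)))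

  Standard : ℕ → (ℕ → V) → (ℕ → V) → Set
  Standard k a b =
    Congruent k a b ×
    (∀ i → 1 ≤ i → i + 2 ≤ k → (a i ≡ a (i + 2)) ⊎ (b i ≡ b (i + 2)))

  InF : V → V → Set
  InF a b = a ≢ b × SamePart a b

  Γ : V → V → V → V → Set
  Γ a b f g =
    InF a b × InF f g ×
    Σ ℕ λ k → Σ (ℕ → V) λ p → Σ (ℕ → V) λ q →
      1 ≤ k × Congruent k p q ×
      p 1 ≡ a × q 1 ≡ b × p k ≡ f × q k ≡ g

  -- (a , b) ∈ 𝓕 is relevant: its implication class contains at least two
  -- (distinct) pairs.
  Relevant : V → V → Set
  Relevant a b =
    InF a b ×
    Σ V λ f → Σ V λ g → Σ V λ f' → Σ V λ g' →
      Γ a b f g × Γ a b f' g' × ((f ≢ f') ⊎ (g ≢ g'))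

module Submission where

-- We replace Γ by the relation "linked": the reflexive–transitive closure
-- of the step (a,b) ⟶ (a',b') given by independent edges aa', bb'.  Any
-- congruent walks give such a chain and conversely (linked⇒Γ, Γ⇒linked), so
-- linked pairs form an equivalence relation that can be inverted and
-- swapped.  Call c apart from (a,b) if c ≠ a, b and neither (a,c) nor (c,b)
-- is linked to (a,b); apartness and "(a,c) has an outgoing step" are
-- transported along links.  The graph-theoretic heart is the dichotomy (c
-- sees both or neither of the next vertices a', b') and its consequence
-- double-step: across two steps of a standard pair of walks, (a,c) stays
-- linked to (a'',c) and (c,b) to (c,b'').  Induction over the odd indices
-- then gives the first two claims, and the dichotomy at the last step the
-- third.

open import Defs
open import Data.Nat using (ℕ; zero; suc; _≤_; _∸_; _%_; s≤s; z≤n)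
open import Data.Nat.Properties using (≤-trans; n≤1+n; ≤-refl; +-comm)
open import Data.Bool using (true; not) renaming (_≟_ to _≟ᵇ_)
open import Data.Bool.Properties using (¬-not)
open import Data.Fin.Properties using (_≟_)
open import Data.Product using (Σ; _×_; _,_; proj₁; proj₂; swap)
open import Data.Product.Properties using (≡-dec)
open import Data.Sum using (_⊎_; inj₁; inj₂; [_,_])
open import Data.Empty using (⊥-elim)
open import Relation.Nullary using (¬_; Dec; yes; no)
open import Relation.Binary.PropositionalEquality
  using (_≡_; _≢_; refl; sym; trans; cong; subst; ≢-sym)
open import Relation.Binary.Construct.Closure.ReflexiveTransitive
  using (Star; ε; _◅_; _◅◅_; reverse; gmap)

-- Odd natural numbers, generated from 1 by adding 2; the induction along
-- the walks visits exactly these indices.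
data Odd : ℕ → Set where
  one : Odd 1
  2+_ : ∀ {j} → Odd j → Odd (suc (suc j))

odd : ∀ k → k % 2 ≡ 1 → Odd k
odd (suc zero)    _ = one
odd (suc (suc k)) h = 2+ odd k h

odd-pos : ∀ {j} → Odd j → 1 ≤ j
odd-pos one    = s≤s z≤n
odd-pos (2+ _) = s≤s z≤n

two-less : ∀ {j k} → suc (suc j) ≤ k → j ≤ k
two-less {j} le = ≤-trans (≤-trans (n≤1+n j) (n≤1+n (suc j))) le

module Linking (G : BipartiteGraph) where
  open BipartiteGraph G using (adj; adj-sym; bipartite)

  Pair : Set
  Pair = V G × V G

  adjacent? : ∀ u v → Dec (E G u v)
  adjacent? u v = adj u v ≟ᵇ true

  edge-sym : ∀ {u v} → E G u v → E G v u
  edge-sym {u} {v} e = trans (adj-sym v u) e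

  nonedge-sym : ∀ {u v} → ¬ E G u v → ¬ E G v u
  nonedge-sym ¬e e = ¬e (edge-sym e)

  neighbour≢nonneighbour : ∀ {u p q} → E G u p → ¬ E G u q → p ≢ q
  neighbour≢nonneighbour e ¬e refl = ¬e e

  independent-reverse : ∀ {a a' b b'} → Independent G a a' b b' → Independent G a' a b' b
  independent-reverse (e₁ , e₂ , a≢b , a'≢b' , ¬ab' , ¬ba') =
    edge-sym e₁ , edge-sym e₂ , a'≢b' , a≢b , nonedge-sym ¬ba' , nonedge-sym ¬ab'

  independent-swap : ∀ {a a' b b'} → Independent G a a' b b' → Independent G b b' a a'
  independent-swap (e₁ , e₂ , a≢b , a'≢b' , ¬ab' , ¬ba') =
    e₂ , e₁ , ≢-sym a≢b , ≢-sym a'≢b' , ¬ba' , ¬ab'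

  data Step : Pair → Pair → Set where
    step : ∀ {a a' b b'} → Independent G a a' b b' → Step (a , b) (a' , b')

  Linked : Pair → Pair → Set
  Linked = Star Step

  linked-sym : ∀ {p q} → Linked p q → Linked q p
  linked-sym = reverse λ { (step i) → step (independent-reverse i) }

  linked-swap : ∀ {p q} → Linked p q → Linked (swap p) (swap q)
  linked-swap = gmap swap λ { (step i) → step (independent-swap i) }

  step-back : ∀ {a a' b b'} → Independent G a a' b b' → Linked (a' , b') (a , b)
  step-back i = step (independent-reverse i) ◅ ε

  -- The ends of an edge lie in different parts, so a step keeps a pair
  -- inside one part; and independent edges have distinct endpoints, so a
  -- step leads to a pair of distinct vertices.
  step-samePart : ∀ {a a' b b'} → Independent G a a' b b' → SamePart G a b → SamePart G a' b'
  step-samePart {a} {a'} {b} {b'} (e₁ , e₂ , _) same =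
    trans (¬-not (≢-sym (bipartite a a' e₁)))
      (trans (cong not same) (sym (¬-not (≢-sym (bipartite b b' e₂)))))

  linked-samePart : ∀ {a b f g} → Linked (a , b) (f , g) → SamePart G a b → SamePart G f g
  linked-samePart ε              same = same
  linked-samePart (step i ◅ rest) same = linked-samePart rest (step-samePart i same)

  linked-distinct : ∀ {a b f g} → Linked (a , b) (f , g) → a ≢ b → f ≢ g
  linked-distinct ε                                     a≢b = a≢b
  linked-distinct (step (_ , _ , _ , a'≢b' , _) ◅ rest) _ = linked-distinct rest a'≢b'

  linked-InF : ∀ {a b f g} → Linked (a , b) (f , g) → InF G a b → InF G f g
  linked-InF r (a≢b , same) = linked-distinct r a≢b , linked-samePart r same

  Walks : V G → V G → V G → V G → Set
  Walks a b f g =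
    Σ ℕ λ k → Σ (ℕ → V G) λ p → Σ (ℕ → V G) λ q →
      1 ≤ k × Congruent G k p q × p 1 ≡ a × q 1 ≡ b × p k ≡ f × q k ≡ g

  congruent-linked : ∀ {k a b} → Congruent G k a b →
    ∀ j → 1 ≤ j → j ≤ k → Linked (a 1 , b 1) (a j , b j)
  congruent-linked _              (suc zero)    _ _  = ε
  congruent-linked cg@(_ , indep) (suc (suc j)) _ le =
    congruent-linked cg (suc j) (s≤s z≤n) (≤-trans (n≤1+n (suc j)) le)
      ◅◅ step (indep (suc j) (s≤s z≤n) le) ◅ ε

  prepend : V G → (ℕ → V G) → ℕ → V G
  prepend x p zero          = x
  prepend x p (suc zero)    = x
  prepend x p (suc (suc i)) = p (suc i)

  prepend-end : ∀ {x} p k → 1 ≤ k → prepend x p (suc k) ≡ p k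
  prepend-end p (suc k) _ = refl

  linked-walks : ∀ {a b f g} → SamePart G a b → Linked (a , b) (f , g) → Walks a b f g
  linked-walks {a} {b} same ε =
    1 , (λ _ → a) , (λ _ → b) , s≤s z≤n , (same , λ { (suc zero) _ (s≤s ()) }) ,
    refl , refl , refl , refl
  linked-walks {a} {b} same (step i ◅ rest)
    with linked-walks (step-samePart i same) rest
  ... | k , p , q , 1≤k , (_ , indep) , refl , refl , pk , qk =
    suc k , prepend a p , prepend b q , s≤s z≤n , (same , indep') ,
    refl , refl , trans (prepend-end p k 1≤k) pk , trans (prepend-end q k 1≤k) qk
    where
    indep' : ∀ j → 1 ≤ j → suc j ≤ suc k →
      Independent G (prepend a p j) (prepend a p (suc j)) (prepend b q j) (prepend b q (suc j))
    indep' (suc zero)    _ _         = i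
    indep' (suc (suc j)) _ (s≤s le) = indep (suc j) (s≤s z≤n) le

  linked⇒Γ : ∀ {a b f g} → InF G a b → Linked (a , b) (f , g) → Γ G a b f g
  linked⇒Γ ab r = ab , linked-InF r ab , linked-walks (proj₂ ab) r

  Γ⇒linked : ∀ {a b f g} → Γ G a b f g → Linked (a , b) (f , g)
  Γ⇒linked (_ , _ , k , p , q , 1≤k , cg , refl , refl , refl , refl) =
    congruent-linked cg k 1≤k ≤-refl

  -- A pair is active if some step leaves it.  Activity is invariant along
  -- chains, and a relevant pair is active since it is linked to a pair
  -- other than itself.
  Active : Pair → Set
  Active p = Σ Pair (Step p)

  active-linked : ∀ {p q} → Linked p q → Active q → Active p
  active-linked ε       act = act
  active-linked (s ◅ _) _   = _ , s

  linked-moves : ∀ {p q} → Linked p q → p ≢ q → Active p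
  linked-moves ε       p≢p = ⊥-elim (p≢p refl)
  linked-moves (s ◅ _) _   = _ , s

  relevant-active : ∀ {a b} → Relevant G a b → Active (a , b)
  relevant-active {a} {b} (_ , f , g , f' , g' , Γ₁ , Γ₂ , differ)
    with ≡-dec _≟_ _≟_ (a , b) (f , g)
  ... | no moved  = linked-moves (Γ⇒linked Γ₁) moved
  ... | yes refl  = linked-moves (Γ⇒linked Γ₂)
    λ eq → [ (λ d → d (cong proj₁ eq)) , (λ d → d (cong proj₂ eq)) ] differ

  Apart : V G → V G → V G → Set
  Apart a b c = c ≢ a × c ≢ b × ¬ Linked (a , c) (a , b) × ¬ Linked (c , b) (a , b)

  apart-swap : ∀ {a b c} → Apart a b c → Apart b a c
  apart-swap (c≢a , c≢b , ¬ac , ¬cb) =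
    c≢b , c≢a , (λ r → ¬cb (linked-swap r)) , (λ r → ¬ac (linked-swap r))

  apart-linked : ∀ {a b a' b' c} →
    Linked (a , c) (a' , c) → Linked (c , b) (c , b') → Linked (a , b) (a' , b') →
    Apart a b c → Apart a' b' c
  apart-linked ra rb rab (c≢a , c≢b , ¬ac , ¬cb) =
    ≢-sym (linked-distinct ra (≢-sym c≢a)) , linked-distinct rb c≢b ,
    (λ r → ¬ac (ra ◅◅ r ◅◅ linked-sym rab)) ,
    (λ r → ¬cb (rb ◅◅ r ◅◅ linked-sym rab))

  -- Dichotomy: if c is apart from (a,b) and aa', bb' are independent,
  -- then c is adjacent to both a', b' or to neither; otherwise (c,b) or
  -- (a,c) steps to (a',b'), which steps back to (a,b).
  dichotomy : ∀ {a a' b b' c} → Independent G a a' b b' → Apart a b c →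
    (E G c a' × E G c b') ⊎ (¬ E G c a' × ¬ E G c b')
  dichotomy {a} {a'} {b} {b'} {c} I@(e₁ , e₂ , _ , a'≢b' , ¬ab' , ¬ba') (c≢a , c≢b , ¬ac , ¬cb)
    with adjacent? c a' | adjacent? c b'
  ... | yes ca' | yes cb' = inj₁ (ca' , cb')
  ... | no ¬ca' | no ¬cb' = inj₂ (¬ca' , ¬cb')
  ... | yes ca' | no ¬cb' =
    ⊥-elim (¬cb (step (ca' , e₂ , c≢b , a'≢b' , ¬cb' , ¬ba') ◅ step-back I))
  ... | no ¬ca' | yes cb' =
    ⊥-elim (¬ac (step (e₁ , cb' , ≢-sym c≢a , a'≢b' , ¬ab' , ¬ca') ◅ step-back I))

  -- In the case "c sees a' and b'", every neighbour p of a missed by c is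
  -- a neighbour of b: otherwise (a,c) ⟶ (p,b') ⟶ (a,b).
  both-case-neighbour : ∀ {a a' b b' c p} → Independent G a a' b b' → Apart a b c →
    E G c b' → E G a p → ¬ E G c p → E G b p
  both-case-neighbour {b = b} {p = p} (_ , e₂ , a≢b , _ , ¬ab' , _) (c≢a , _ , ¬ac , _) cb' ap ¬cp
    with adjacent? b p
  ... | yes bp = bp
  ... | no ¬bp = ⊥-elim (¬ac
    (step (ap , cb' , ≢-sym c≢a , p≢b' , ¬ab' , ¬cp) ◅
     step (edge-sym ap , edge-sym e₂ , p≢b' , a≢b , nonedge-sym ¬bp , nonedge-sym ¬ab') ◅ ε))
    where
    p≢b' = neighbour≢nonneighbour ap ¬ab'

  -- In the case "c misses a' and b'", every neighbour q of c missed by a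
  -- is missed by b: otherwise (a,c) ⟶ (a',q) ⟶ (a,b).
  neither-case-neighbour : ∀ {a a' b b' c q} → Independent G a a' b b' → Apart a b c →
    ¬ E G c a' → E G c q → ¬ E G a q → ¬ E G b q
  neither-case-neighbour (e₁ , _ , a≢b , _ , _ , ¬ba') (c≢a , _ , ¬ac , _) ¬ca' cq ¬aq bq =
    ¬ac (step (e₁ , cq , ≢-sym c≢a , a'≢q , ¬aq , ¬ca') ◅
         step (edge-sym e₁ , edge-sym bq , a'≢q , a≢b , nonedge-sym ¬ba' , nonedge-sym ¬aq) ◅ ε)
    where
    a'≢q = neighbour≢nonneighbour e₁ ¬aq

  active-exchange : ∀ {a a' b b' c} → Independent G a a' b b' → Apart a b c →
    Active (a , c) → Active (b , c)
  active-exchange {a' = a'} {b' = b'} I@(_ , e₂ , _ , _ , _ , ¬ba') apart@(_ , c≢b , _)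
    ((p , q) , step (ap , cq , _ , _ , ¬aq , ¬cp))
    with dichotomy I apart
  ... | inj₁ (ca' , cb') =
    let bp = both-case-neighbour I apart cb' ap ¬cp in
    (p , a') , step (bp , ca' , ≢-sym c≢b , neighbour≢nonneighbour bp ¬ba' , ¬ba' , ¬cp)
  ... | inj₂ (¬ca' , ¬cb') =
    let ¬bq = neither-case-neighbour I apart ¬ca' cq ¬aq in
    (b' , q) , step (e₂ , cq , ≢-sym c≢b , neighbour≢nonneighbour e₂ ¬bq , ¬bq , ¬cb')

  -- The two lemmas
  -- below are the two cases of the dichotomy; in each, the witness of
  -- activity either gives the link or links (c,b) to (a,b).
  advance-both : ∀ {a a' a'' b b' c p q} → Independent G a a' b b' → Independent G a' a'' b' b →
    Apart a b c → E G c a' → E G c b' → Independent G a p c q → Linked (a , c) (a'' , c)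
  advance-both {a'' = a''} {p = p} I₁@(_ , _ , _ , _ , ¬ab' , ¬ba') I₂@(e₁' , _ , _ , a''≢b , ¬a'b , ¬b'a'')
    apart@(c≢a , c≢b , _ , ¬cb) ca' cb' (ap , _ , _ , _ , _ , ¬cp)
    with adjacent? p a''
  ... | yes pa'' =
    step (ap , cb' , ≢-sym c≢a , p≢b' , ¬ab' , ¬cp) ◅
    step (pa'' , edge-sym cb' , p≢b' , a''≢c , nonedge-sym ¬cp , ¬b'a'') ◅ ε
    where
    p≢b' = neighbour≢nonneighbour ap ¬ab'
    a''≢c = λ a''≡c → ¬b'a'' (subst (E G _) (sym a''≡c) (edge-sym cb'))
  ... | no ¬pa'' = ⊥-elim (¬cb
    (step (ca' , bp , c≢b , a'≢p , ¬cp , ¬ba') ◅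
     step (e₁' , edge-sym bp , a'≢p , a''≢b , ¬a'b , ¬pa'') ◅
     step-back I₂ ◅◅ step-back I₁))
    where
    bp = both-case-neighbour I₁ apart cb' ap ¬cp
    a'≢p = ≢-sym (neighbour≢nonneighbour bp ¬ba')

  advance-neither : ∀ {a a' a'' b b' c p q} → Independent G a a' b b' → Independent G a' a'' b' b →
    Apart a b c → ¬ E G c a' → ¬ E G c b' → Independent G a p c q → Linked (a , c) (a'' , c)
  advance-neither {a'' = a''} {q = q} I₁@(e₁ , e₂ , _ , _ , _ , _) I₂@(e₁' , e₂' , _ , a''≢b , _ , ¬b'a'')
    apart@(c≢a , c≢b , _ , ¬cb) ¬ca' ¬cb' (_ , cq , _ , _ , ¬aq , _)
    with adjacent? q a''
  ... | no ¬qa'' =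
    step (e₁ , cq , ≢-sym c≢a , a'≢q , ¬aq , ¬ca') ◅
    step (e₁' , edge-sym cq , a'≢q , a''≢c , nonedge-sym ¬ca' , ¬qa'') ◅ ε
    where
    a'≢q = neighbour≢nonneighbour e₁ ¬aq
    a''≢c = λ a''≡c → ¬ca' (subst (λ z → E G z _) a''≡c (edge-sym e₁'))
  ... | yes qa'' = ⊥-elim (¬cb
    (step (cq , e₂ , c≢b , q≢b' , ¬cb' , ¬bq) ◅
     step (qa'' , e₂' , q≢b' , a''≢b , nonedge-sym ¬bq , ¬b'a'') ◅
     step-back I₂ ◅◅ step-back I₁))
    where
    ¬bq = neither-case-neighbour I₁ apart ¬ca' cq ¬aq
    q≢b' = ≢-sym (neighbour≢nonneighbour e₂ ¬bq)

  advance : ∀ {a a' a'' b b' c} → Independent G a a' b b' → Independent G a' a'' b' b →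
    Apart a b c → Active (a , c) → Linked (a , c) (a'' , c)
  advance I₁ I₂ apart (_ , step W) with dichotomy I₁ apart
  ... | inj₁ (ca' , cb')   = advance-both I₁ I₂ apart ca' cb' W
  ... | inj₂ (¬ca' , ¬cb') = advance-neither I₁ I₂ apart ¬ca' ¬cb' W

  -- Two steps of standard walks: one of the walks returns, and by
  -- advance (applied directly, or to the swapped walks after
  -- active-exchange) c keeps its links.
  double-step : ∀ {a a' a'' b b' b'' c} →
    Independent G a a' b b' → Independent G a' a'' b' b'' → (a ≡ a'' ⊎ b ≡ b'') →
    Apart a b c → Active (a , c) → Linked (a , c) (a'' , c) × Linked (c , b) (c , b'')
  double-step I₁ I₂ (inj₂ refl) apart act = advance I₁ I₂ apart act , ε
  double-step I₁ I₂ (inj₁ refl) apart act =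
    ε , linked-swap (advance (independent-swap I₁) (independent-swap I₂)
                             (apart-swap apart) (active-exchange I₁ apart act))

  module AlongStandardWalks {k : ℕ} {a b : ℕ → V G} {c : V G} (std : Standard G k a b)
    (apart : Apart (a 1) (b 1) c) (active : Active (a 1 , c)) where

    -- Consecutive edges are independent, and of two consecutive steps one
    -- walk returns to where it was (the index j + 2 written as suc (suc j)).
    independent : ∀ j → 1 ≤ j → suc j ≤ k → Independent G (a j) (a (suc j)) (b j) (b (suc j))
    independent = proj₂ (proj₁ std)

    returns : ∀ j → 1 ≤ j → suc (suc j) ≤ k → a j ≡ a (suc (suc j)) ⊎ b j ≡ b (suc (suc j))
    returns j 1≤j le =
      subst (λ m → a j ≡ a m ⊎ b j ≡ b m) (+-comm j 2)
            (proj₂ std j 1≤j (subst (_≤ k) (+-comm 2 j) le))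

    apart-at : ∀ {j} → Odd j → j ≤ k →
      Linked (a 1 , c) (a j , c) → Linked (c , b 1) (c , b j) → Apart (a j) (b j) c
    apart-at o le ra rb =
      apart-linked ra rb (congruent-linked (proj₁ std) _ (odd-pos o) le) apart

    reach : ∀ {j} → Odd j → j ≤ k → Linked (a 1 , c) (a j , c) × Linked (c , b 1) (c , b j)
    reach one    _ = ε , ε
    reach (2+_ {j} o) le =
      let ra , rb   = reach o (two-less le)
          ra' , rb' = double-step (independent j (odd-pos o) (≤-trans (n≤1+n _) le))
                                  (independent (suc j) (s≤s z≤n) le) (returns j (odd-pos o) le)
                                  (apart-at o (two-less le) ra rb)
                                  (active-linked (linked-sym ra) active)
      in ra ◅◅ ra' , rb ◅◅ rb'

    last-step : ∀ {j} → Odd j → 3 ≤ j → j ≤ k →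
      (E G c (a (j ∸ 1)) × E G c (b (j ∸ 1))) ⊎ (¬ E G c (a (j ∸ 1)) × ¬ E G c (b (j ∸ 1)))
    last-step (2+ o) (s≤s (s≤s 1≤j)) le =
      let ra , rb = reach o (two-less le) in
      dichotomy (independent _ 1≤j (≤-trans (n≤1+n _) le)) (apart-at o (two-less le) ra rb)

proposition3p2 : (G : BipartiteGraph) → (k : ℕ) → k % 2 ≡ 1 →
    (a b : ℕ → V G) → Standard G k a b →
    BipartiteGraph.inX G (a 1) ≡ true → BipartiteGraph.inX G (b 1) ≡ true → a 1 ≢ b 1 →
    (c : V G) → BipartiteGraph.inX G c ≡ true → c ≢ a 1 → c ≢ b 1 →
    Relevant G (a 1) c →
    ¬ Γ G (a 1) c (a 1) (b 1) →
    ¬ Γ G c (b 1) (a 1) (b 1) →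
    Γ G (a 1) c (a k) c × Γ G c (b 1) c (b k) ×
    (3 ≤ k → (E G c (a (k ∸ 1)) × E G c (b (k ∸ 1))) ⊎ (¬ E G c (a (k ∸ 1)) × ¬ E G c (b (k ∸ 1))))
proposition3p2 G k k-odd a b std a∈X b∈X _ c c∈X c≢a c≢b relevant ¬Γ₁ ¬Γ₂ =
  linked⇒Γ ac (proj₁ reached) , linked⇒Γ cb (proj₂ reached) ,
  λ 3≤k → last-step (odd k k-odd) 3≤k ≤-refl
  where
  open Linking G
  ac : InF G (a 1) c
  ac = ≢-sym c≢a , trans a∈X (sym c∈X)
  cb : InF G c (b 1)
  cb = c≢b , trans c∈X (sym b∈X)
  apart : Apart (a 1) (b 1) c
  apart = c≢a , c≢b , (λ r → ¬Γ₁ (linked⇒Γ ac r)) , (λ r → ¬Γ₂ (linked⇒Γ cb r))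
  open AlongStandardWalks std apart (relevant-active relevant)
  reached : Linked (a 1 , c) (a k , c) × Linked (c , b 1) (c , b k)
  reached = reach (odd k k-odd) ≤-refl
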